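{- Every hole-free polyomino with $m+1$ cells is (up to translation) the Chan polyomino of some Tangle of size $m$.
   Context: Fix $r>0$ and consider the circles of radius $r$ centered at the points of $L_1=2\sqrt2\,r\,\mathbb Z^2$ and of $L_2=2\sqrt2\,r\,(\mathbb Z^2+(\tfrac12,\tfrac12))$ (a square packing of the plane in which each circle is tangent to four others at its NE, NW, SW, SE points). A (planar) Tangle is a smooth simple closed plane curve that is a finite union of links, each link being a quarter of one of these circles joining two consecutive intercardinal points of that circle. Dual graph: the circles of the packing that contain a link of $T$ and whose disks lie in the closed region bounded by $T$ all have centers in the same one of $L_1,L_2$; call it $L_T$. The vertices of the dual graph are the points of $L_T$ that are centers of circles whose disks lie in the closed region bounded by $T$; two vertices are joined by an edge if they differ by $(\pm2\sqrt2 r,0)$ or $(0,\pm2\sqrt2 r)$ and the segment joining them does not meet $T$. The size of $T$ is the number of edges of its dual graph. A polyomino is a finite union of unit cells $[i,i+1]\times[j,j+1]$ ($i,j\in\mathbb Z$) that is connected through shared cell edges, considered up to translation; it is hole-free if its complement in the plane is connected (equivalently its boundary is a single self-avoiding polygon). Chan polyomino: fixing a point $p\in L_T$, identify each vertex $v$ of the dual graph with $(i,j)=(v-p)/(2\sqrt2 r)\in\mathbb Z^2$; the Chan polyomino of $T$ is the union of the cells $[i,i+1]\times[j,j+1]$ over all vertices $(i,j)$ (well defined up to translation). -}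

module Defs where

open import Data.Nat as ℕ using (ℕ; zero; suc)
open import Data.Integer as ℤ using (ℤ; +_; _+_; _*_; -_; _-_)
open import Data.Bool using (Bool; true; false; if_then_else_; _∧_; _∨_)
open import Data.Product using (Σ; _×_; _,_; proj₁; proj₂)
open import Data.Sum using (_⊎_)
open import Data.List using (List; []; _∷_; _++_; take; length; map)
open import Data.List.Membership.Propositional using (_∈_; _∉_)
open import Data.List.Relation.Unary.Any using (Any)
open import Data.List.Relation.Unary.All using (All)
open import Data.List.Relation.Unary.Linked using (Linked)
open import Data.List.Relation.Unary.Unique.Propositional using (Unique)
open import Relation.Binary.PropositionalEquality using (_≡_)
open import Relation.Nullary using (¬_; does)
open import Function.Bundles using (_⇔_)

-- We rescale the plane by the factor √2 / r, so that
--   L₁ = 2√2 r ℤ²            becomes  4ℤ²,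
--   L₂ = 2√2 r (ℤ² + (½,½))  becomes  4ℤ² + (2,2),
-- every circle has radius √2, and the intercardinal points of the
-- circle with centre c are c + (±1, ±1) (integer points).

Pt : Set
Pt = ℤ × ℤ

_⊕_ : Pt → Pt → Pt
(a , b) ⊕ (c , d) = (a + c , b + d)

IsCenter : Pt → Set
IsCenter (x , y) = Σ ℤ λ i → Σ ℤ λ j →
  ((x ≡ + 4 * i) × (y ≡ + 4 * j)) ⊎ ((x ≡ + 4 * i + + 2) × (y ≡ + 4 * j + + 2))

SameLattice : Pt → Pt → Set
SameLattice (x , y) (x' , y') = Σ ℤ λ i → Σ ℤ λ j → (x ≡ x' + + 4 * i) × (y ≡ y' + + 4 * j)

-- Links: a quarter of a circle between two consecutive intercardinal
-- points.  Side N is the arc from NE to NW (through the north point), etc.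

data Side : Set where
  N E S W : Side

data Orient : Set where
  ccw cw : Orient

record OLink : Set where
  constructor olink
  field
    center : Pt
    side   : Side
    orient : Orient
open OLink public

ccwStart : Side → Pt
ccwStart N = (+ 1 , + 1)
ccwStart W = (- + 1 , + 1)
ccwStart S = (- + 1 , - + 1)
ccwStart E = (+ 1 , - + 1)

ccwEnd : Side → Pt
ccwEnd N = (- + 1 , + 1)
ccwEnd W = (- + 1 , - + 1)
ccwEnd S = (+ 1 , - + 1)
ccwEnd E = (+ 1 , + 1)

startOff : OLink → Pt
startOff (olink _ s ccw) = ccwStart s
startOff (olink _ s cw)  = ccwEnd s

endOff : OLink → Pt
endOff (olink _ s ccw) = ccwEnd s
endOff (olink _ s cw)  = ccwStart s

startPt : OLink → Pt
startPt l = center l ⊕ startOff l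

endPt : OLink → Pt
endPt l = center l ⊕ endOff l

-- tangent direction (up to positive scaling) at the point c + (a,b)
-- of the circle of centre c, traversed in the given orientation
tangent : Orient → Pt → Pt
tangent ccw (a , b) = (- b , a)
tangent cw  (a , b) = (b , - a)

startTan : OLink → Pt
startTan l = tangent (orient l) (startOff l)

endTan : OLink → Pt
endTan l = tangent (orient l) (endOff l)

-- l is followed by l' along the curve: l ends where l' starts, and the
-- curve is smooth (C¹, same oriented tangent direction) there
Follows : OLink → OLink → Set
Follows l l' = (endPt l ≡ startPt l') × (endTan l ≡ startTan l')

-- Tangles: a cyclic sequence of oriented links, closing up smoothly,
-- visiting each junction point once (simple closed curve).

record Tangle : Set where
  field
    links   : List OLink
    centers : All (λ l → IsCenter (center l)) links
    closed  : Linked Follows (links ++ take 1 links)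
    simple  : Unique (map startPt links)
    nonempty : 1 ℕ.≤ length links
open Tangle public

HasLink : Tangle → Pt → Side → Set
HasLink T c s = Any (λ l → (center l ≡ c) × (side l ≡ s)) (links T)

-- The horizontal ray from a centre v = (x,y) to the right
-- meets T only transversally, at east points of circles centred at
-- (x',y) with x' ≥ x and west points of circles centred at (x',y) with
-- x' > x.  A centre is inside T iff this number of crossings is odd.

isE isW : Side → Bool
isE E = true
isE _ = false
isW W = true
isW _ = false

rayHit : Pt → OLink → Bool
rayHit (x , y) l with center l
... | (x' , y') = does (y' ℤ.≟ y) ∧ ((isE (side l) ∧ does (x ℤ.≤? x')) ∨ (isW (side l) ∧ does (x ℤ.<? x')))

rayCount : Pt → List OLink → ℕ
rayCount v [] = 0
rayCount v (l ∷ ls) = (if rayHit v l then 1 else 0) ℕ.+ rayCount v ls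

-- the disk of the circle with centre v lies in the closed region bounded by T
Inside : Tangle → Pt → Set
Inside T v = IsCenter v × (rayCount v (links T) ℕ.% 2 ≡ 1)

-- v is a point of L_T that is the centre of a disk inside T, where L_T is
-- the lattice of the link-circles whose disks lie inside T
DualVertex : Tangle → Pt → Set
DualVertex T v = Inside T v ×
  Any (λ l → Inside T (center l) × SameLattice v (center l)) (links T)

data Dir : Set where
  H V : Dir

Edge : Set
Edge = Pt × Dir

step : Dir → Pt
step H = (+ 4 , + 0)
step V = (+ 0 , + 4)

-- the segment from v to v+step meets T iff T contains the corresponding
-- cardinal arc of one of its two end circles
SegMeets : Tangle → Edge → Set
SegMeets T (v , H) = HasLink T v E ⊎ HasLink T (v ⊕ step H) W
SegMeets T (v , V) = HasLink T v N ⊎ HasLink T (v ⊕ step V) S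

IsEdge : Tangle → Edge → Set
IsEdge T (v , d) = DualVertex T v × DualVertex T (v ⊕ step d) × ¬ SegMeets T (v , d)

HasSize : Tangle → ℕ → Set
HasSize T m = Σ (List Edge) λ es →
  Unique es × (length es ≡ m) × (∀ e → (e ∈ es) ⇔ IsEdge T e)

-- Polyominoes: finite lists of cells (i,j) ↦ [i,i+1]×[j,j+1]

Cell : Set
Cell = ℤ × ℤ

Adj : Cell → Cell → Set
Adj (i , j) (i' , j') =
  ((i' ≡ i + + 1) × (j' ≡ j)) ⊎ ((i ≡ i' + + 1) × (j' ≡ j)) ⊎
  ((j' ≡ j + + 1) × (i' ≡ i)) ⊎ ((j ≡ j' + + 1) × (i' ≡ i))

data Conn (S : Cell → Set) : Cell → Cell → Set where
  here : ∀ {a} → S a → Conn S a a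
  next : ∀ {a b c} → S a → Adj a b → Conn S b c → Conn S a c

IsPolyomino : List Cell → Set
IsPolyomino P = Unique P × (∀ a b → a ∈ P → b ∈ P → Conn (λ c → c ∈ P) a b)

-- complement connected (through shared cell edges, which is connectivity
-- of the complement in the plane)
HoleFree : List Cell → Set
HoleFree P = ∀ a b → a ∉ P → b ∉ P → Conn (λ c → c ∉ P) a b

ChanIs : Tangle → List Cell → Set
ChanIs T P = Σ Pt λ a →
  (∀ c → c ∈ P → DualVertex T (a ⊕ (+ 4 * proj₁ c , + 4 * proj₂ c))) ×
  (∀ v → DualVertex T v → Σ Cell λ c → (c ∈ P) × (v ≡ a ⊕ (+ 4 * proj₁ c , + 4 * proj₂ c)))

-- Grow the polyomino one cell at a time along a spanning tree, keeping a tangle that encloses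
-- exactly the centres of the cells added so far and whose dual graph is that tree. One cell is
-- enclosed by the four arcs of its circle. A neighbour c of an enclosed cell u is added by
-- replacing the arc of u facing c with a detour: an arc of one circle of the other lattice
-- touching both, the three remaining arcs of c's circle, and an arc of the second circle of the
-- other lattice touching both. The curve stays smooth and simple, the parity of ray crossings
-- changes only at the centre of c, and the only new dual edge is the one between u and c.
-- With m + 1 cells the tree has m edges.
module Submission where

open import Defs
open import Data.Nat using (ℕ; suc)
open import Data.List using (List; length)
open import Data.Product using (Σ; _×_)
open import Relation.Binary.PropositionalEquality using (_≡_)

open import Data.Bool using (Bool; true; false; _∧_; _∨_; _xor_; if_then_else_)
import Data.Bool.Properties as Bool
open import Data.Empty using (⊥-elim)
open import Data.Integer as ℤ using (ℤ; +_; -[1+_]; +[1+_]; _+_; _*_; -_; _-_)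
import Data.Integer.Properties as ℤ
open import Algebra.Properties.AbelianGroup ℤ.+-0-abelianGroup using (∙-cancelˡ; ∙-cancelʳ)
open import Data.Integer.Tactic.RingSolver using (solve-∀)
open import Data.List using ([]; _∷_; [_]; _++_; map; take)
import Data.List.Properties as List
open import Data.List.Membership.Propositional using (_∈_; _∉_; find; lose)
open import Data.List.Membership.Propositional.Properties
  using (∈-map⁺; ∈-map⁻; ∈-++⁺ˡ; ∈-++⁺ʳ; ∈-++⁻; ∈-∃++; ∈-length)
open import Data.List.Relation.Binary.Permutation.Propositional as ↭ using (_↭_)
import Data.List.Relation.Binary.Permutation.Propositional.Properties as ↭
open import Data.List.Relation.Binary.Permutation.Propositional.Properties using (All-resp-↭; ∈-resp-↭)
open import Data.List.Relation.Unary.All as All using (All; []; _∷_)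
import Data.List.Relation.Unary.All.Properties as All
open import Data.List.Relation.Unary.AllPairs using ([]; _∷_)
open import Data.List.Relation.Unary.Any using (here; there)
open import Data.List.Relation.Unary.Linked using (Linked; []; [-]; _∷_)
open import Data.List.Relation.Unary.Unique.Propositional using (Unique)
import Data.List.Relation.Unary.Unique.Propositional.Properties as Unique
open import Data.Nat using (zero)
import Data.Nat as ℕ
import Data.Nat.Properties as ℕ
open import Data.Nat.DivMod using (_%_; %-distribˡ-+)
open import Data.Product using (_,_; proj₁; proj₂; uncurry)
open import Data.Sum as Sum using (_⊎_; inj₁; inj₂)
open import Function using (_∘_; id)
open import Function.Bundles using (_⇔_; mk⇔)
open import Relation.Binary.PropositionalEquality as ≡
  using (_≢_; refl; sym; trans; cong; cong₂; subst; subst₂; module ≡-Reasoning)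
open import Relation.Nullary using (¬_; Dec; yes; no; does; _×-dec_)
open import Relation.Nullary.Decidable using (dec-true; dec-false; does-⇔; map′; from-yes)

infix 4 _≟P_

-- decided componentwise, so that does (v ≟P p) unfolds to a conjunction
_≟P_ : (p q : Pt) → Dec (p ≡ q)
(x , y) ≟P (a , b) =
  map′ (uncurry (cong₂ _,_)) (λ eq → cong proj₁ eq , cong proj₂ eq) (x ℤ.≟ a ×-dec y ℤ.≟ b)

open import Data.List.Relation.Unary.Unique.DecPropositional _≟P_ using (unique?)
open import Data.List.Membership.DecPropositional _≟P_ using (_∈?_)
import Data.List.Relation.Binary.Permutation.Setoid.Properties (≡.setoid Pt) as PermPt

⊕-assoc : ∀ p q r → (p ⊕ q) ⊕ r ≡ p ⊕ (q ⊕ r)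
⊕-assoc (x , y) (a , b) (c , d) = cong₂ _,_ (ℤ.+-assoc x a c) (ℤ.+-assoc y b d)

⊕-assoc₃ : ∀ q a b c → ((q ⊕ a) ⊕ b) ⊕ c ≡ q ⊕ (a ⊕ (b ⊕ c))
⊕-assoc₃ q a b c = trans (⊕-assoc (q ⊕ a) b c) (⊕-assoc q a (b ⊕ c))

⊕-identityˡ : ∀ p → (+ 0 , + 0) ⊕ p ≡ p
⊕-identityˡ (x , y) = cong₂ _,_ (ℤ.+-identityˡ x) (ℤ.+-identityˡ y)

⊕-cancelˡ : ∀ p {q r} → p ⊕ q ≡ p ⊕ r → q ≡ r
⊕-cancelˡ (x , y) eq = cong₂ _,_ (∙-cancelˡ x _ _ (cong proj₁ eq)) (∙-cancelˡ y _ _ (cong proj₂ eq))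

double : Pt → Pt
double p = p ⊕ p

cellCentre : Cell → Pt
cellCentre c = (+ 4 * proj₁ c , + 4 * proj₂ c)

cellCentre-injective : ∀ {c c′} → cellCentre c ≡ cellCentre c′ → c ≡ c′
cellCentre-injective eq =
  cong₂ _,_ (ℤ.*-cancelˡ-≡ (+ 4) _ _ (cong proj₁ eq)) (ℤ.*-cancelˡ-≡ (+ 4) _ _ (cong proj₂ eq))

cellCentre-isCenter : ∀ c → IsCenter (cellCentre c)
cellCentre-isCenter (i , j) = i , j , inj₁ (refl , refl)

∈?-single : ∀ v x → does (v ∈? [ x ]) ≡ does (v ≟P x)
∈?-single v x = Bool.∨-identityʳ (does (v ≟P x))

∈?-fresh : ∀ {x xs} v → x ∉ xs → does (v ∈? x ∷ xs) ≡ does (v ∈? xs) xor does (v ≟P x)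
∈?-fresh {x} {xs} v x∉xs = go (v ≟P x)
  where
  go : (d : Dec (v ≡ x)) → does d ∨ does (v ∈? xs) ≡ does (v ∈? xs) xor does d
  go (yes refl) = cong (_xor true) (sym (dec-false (v ∈? xs) x∉xs))
  go (no _)     = sym (Bool.xor-identityʳ _)

cellCentre-∈ : ∀ {c Q} → cellCentre c ∈ map cellCentre Q → c ∈ Q
cellCentre-∈ {Q = Q} m with c′ , c′∈Q , eq ← ∈-map⁻ cellCentre m =
  subst (_∈ Q) (sym (cellCentre-injective eq)) c′∈Q

4i≢4j+2 : ∀ i j → + 4 * i ≢ + 4 * j + + 2
4i≢4j+2 i j eq = 4k≢2 (i - j) (trans (expand i j) (trans (cong (_- + 4 * j) eq) (collapse j)))
  where
  -- k * + 4 rather than + 4 * k: ℕ multiplication recurses on its left argument, so this form normalises.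
  4k≢2 : ∀ k → k * + 4 ≢ + 2
  4k≢2 (+ 0) ()
  4k≢2 +[1+ n ] ()
  4k≢2 -[1+ n ] ()
  expand : ∀ i j → (i - j) * + 4 ≡ + 4 * i - + 4 * j
  expand = solve-∀
  collapse : ∀ j → + 4 * j + + 2 - + 4 * j ≡ + 2
  collapse = solve-∀

data IsUnit : ℤ → Set where
  plus  : IsUnit (+ 1)
  minus : IsUnit -[1+ 0 ]

4i+1≢4j-1 : ∀ i j → + 4 * i + + 1 ≢ + 4 * j + -[1+ 0 ]
4i+1≢4j-1 i j eq = 4i≢4j+2 j i (trans (lower j) (trans (cong (_+ + 1) (sym eq)) (raise i)))
  where
  lower : ∀ j → + 4 * j ≡ + 4 * j + -[1+ 0 ] + + 1
  lower = solve-∀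
  raise : ∀ i → + 4 * i + + 1 + + 1 ≡ + 4 * i + + 2
  raise = solve-∀

4i+ε-injective : ∀ {i j ε ε′} → IsUnit ε → IsUnit ε′ → + 4 * i + ε ≡ + 4 * j + ε′ → i ≡ j
4i+ε-injective         plus  plus  eq = ℤ.*-cancelˡ-≡ (+ 4) _ _ (∙-cancelʳ _ _ _ eq)
4i+ε-injective         minus minus eq = ℤ.*-cancelˡ-≡ (+ 4) _ _ (∙-cancelʳ _ _ _ eq)
4i+ε-injective {i} {j} plus  minus eq = ⊥-elim (4i+1≢4j-1 i j eq)
4i+ε-injective {i} {j} minus plus  eq = ⊥-elim (4i+1≢4j-1 j i (sym eq))

i+1-1≡i : ∀ i → i + + 1 - + 1 ≡ i
i+1-1≡i = solve-∀

i-1+1≡i : ∀ i → i - + 1 + + 1 ≡ i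
i-1+1≡i = solve-∀

4i-2≡4[i-1]+2 : ∀ i → + 4 * i + -[1+ 1 ] ≡ + 4 * (i - + 1) + + 2
4i-2≡4[i-1]+2 = solve-∀

4i-2+2≡4i : ∀ i → + 4 * i + -[1+ 1 ] + + 2 ≡ + 4 * i
4i-2+2≡4i = solve-∀

4i≡4j+4[i-j] : ∀ i j → + 4 * i ≡ + 4 * j + + 4 * (i - j)
4i≡4j+4[i-j] = solve-∀

+-cancelˡ-< : ∀ a {z w} → a + z ℤ.< a + w → z ℤ.< w
+-cancelˡ-< a {z} {w} lt = subst₂ ℤ._<_ (cancel a z) (cancel a w) (ℤ.+-monoʳ-< (- a) lt)
  where
  cancel : ∀ a z → - a + (a + z) ≡ z
  cancel = solve-∀

≤⇔<+4 : ∀ {x} a k → x ≡ a + + 4 * k → (x ℤ.≤ a) ⇔ (x ℤ.< a + + 4)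
≤⇔<+4 a k refl = mk⇔ (λ x≤a → ℤ.≤-<-trans x≤a a<a+4) x≤a
  where
  a<a+4 : a ℤ.< a + + 4
  a<a+4 = subst (ℤ._< a + + 4) (ℤ.+-identityʳ a) (ℤ.+-monoʳ-< a (ℤ.+<+ (ℕ.s≤s ℕ.z≤n)))
  x≤a : a + + 4 * k ℤ.< a + + 4 → a + + 4 * k ℤ.≤ a
  x≤a lt = subst (a + + 4 * k ℤ.≤_) (ℤ.+-identityʳ a) (ℤ.+-monoʳ-≤ a (ℤ.*-monoˡ-≤-nonNeg (+ 4) k≤0))
    where
    k≤0 : k ℤ.≤ + 0
    k≤0 = ℤ.i<j⇒i≤pred[j] (ℤ.*-cancelˡ-<-nonNeg {i = k} {j = + 1} (+ 4) (+-cancelˡ-< a lt))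

sameRow-≤⇔< : ∀ {x a y} → IsCenter (x , y) → IsCenter (a , y) → (x ℤ.≤ a) ⇔ (x ℤ.< a + + 4)
sameRow-≤⇔< (i , j , inj₁ (refl , refl)) (k , l , inj₁ (refl , _)) =
  ≤⇔<+4 (+ 4 * k) (i - k) (4i≡4j+4[i-j] i k)
sameRow-≤⇔< (i , j , inj₂ (refl , refl)) (k , l , inj₂ (refl , _)) =
  ≤⇔<+4 (+ 4 * k + + 2) (i - k) (split i k)
  where
  split : ∀ i k → + 4 * i + + 2 ≡ + 4 * k + + 2 + + 4 * (i - k)
  split = solve-∀
sameRow-≤⇔< (i , j , inj₁ (refl , refl)) (k , l , inj₂ (_ , row)) = ⊥-elim (4i≢4j+2 j l row)
sameRow-≤⇔< (i , j , inj₂ (refl , refl)) (k , l , inj₁ (_ , row)) = ⊥-elim (4i≢4j+2 l j (sym row))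

-- Ray parity

bit : Bool → ℕ
bit b = if b then 1 else 0

eastHit westHit : Pt → Pt → Bool
eastHit (x , y) (a , b) = does (b ℤ.≟ y) ∧ does (x ℤ.≤? a)
westHit (x , y) (a , b) = does (b ℤ.≟ y) ∧ does (x ℤ.<? a)

crosses : Pt → OLink → Bool
crosses v (olink p E _) = eastHit v p
crosses v (olink p W _) = westHit v p
crosses v (olink p N _) = false
crosses v (olink p S _) = false

rayHit≡crosses : ∀ v l → rayHit v l ≡ crosses v l
rayHit≡crosses v (olink p E _) = cong (does (proj₂ p ℤ.≟ proj₂ v) ∧_) (Bool.∨-identityʳ _)
rayHit≡crosses v (olink p W _) = refl
rayHit≡crosses v (olink p N _) = Bool.∧-zeroʳ _
rayHit≡crosses v (olink p S _) = Bool.∧-zeroʳ _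

crossParity : Pt → List OLink → Bool
crossParity v [] = false
crossParity v (l ∷ ls) = crosses v l xor crossParity v ls

rayCount-parity : ∀ v ls → rayCount v ls % 2 ≡ bit (crossParity v ls)
rayCount-parity v [] = refl
rayCount-parity v (l ∷ ls) = begin
  (bit (rayHit v l) ℕ.+ rayCount v ls) % 2
    ≡⟨ %-distribˡ-+ (bit (rayHit v l)) _ 2 ⟩
  (bit (rayHit v l) % 2 ℕ.+ rayCount v ls % 2) % 2
    ≡⟨ cong₂ (λ a b → (bit a % 2 ℕ.+ b) % 2) (rayHit≡crosses v l) (rayCount-parity v ls) ⟩
  (bit (crosses v l) % 2 ℕ.+ bit (crossParity v ls)) % 2
    ≡⟨ bit-xor (crosses v l) (crossParity v ls) ⟩
  bit (crosses v l xor crossParity v ls) ∎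
  where
  open ≡-Reasoning
  bit-xor : ∀ a b → (bit a % 2 ℕ.+ bit b) % 2 ≡ bit (a xor b)
  bit-xor true true = refl
  bit-xor true false = refl
  bit-xor false true = refl
  bit-xor false false = refl

crossParity-++ : ∀ v xs ys → crossParity v (xs ++ ys) ≡ crossParity v xs xor crossParity v ys
crossParity-++ v [] ys = refl
crossParity-++ v (x ∷ xs) ys =
  trans (cong (crosses v x xor_) (crossParity-++ v xs ys)) (sym (Bool.xor-assoc (crosses v x) _ _))

crossParity-↭ : ∀ v {xs ys} → xs ↭ ys → crossParity v xs ≡ crossParity v ys
crossParity-↭ v ↭.refl = refl
crossParity-↭ v (↭.prep x p) = cong (crosses v x xor_) (crossParity-↭ v p)
crossParity-↭ v (↭.swap {xs} {ys} x y p) = begin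
  crosses v x xor (crosses v y xor crossParity v xs)
    ≡⟨ Bool.xor-assoc (crosses v x) _ _ ⟨
  (crosses v x xor crosses v y) xor crossParity v xs
    ≡⟨ cong₂ _xor_ (Bool.xor-comm (crosses v x) _) (crossParity-↭ v p) ⟩
  (crosses v y xor crosses v x) xor crossParity v ys
    ≡⟨ Bool.xor-assoc (crosses v y) _ _ ⟩
  crosses v y xor (crosses v x xor crossParity v ys) ∎
  where open ≡-Reasoning
crossParity-↭ v (↭.trans p q) = trans (crossParity-↭ v p) (crossParity-↭ v q)

xor-sandwich : ∀ a b → a xor (b xor (a xor false)) ≡ b
xor-sandwich true  true  = refl
xor-sandwich true  false = refl
xor-sandwich false true  = refl
xor-sandwich false false = refl

xor-solveˡ : ∀ {a b c} → a xor b ≡ c → a ≡ b xor c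
xor-solveˡ {true}  {true}  refl = refl
xor-solveˡ {true}  {false} refl = refl
xor-solveˡ {false} {true}  refl = refl
xor-solveˡ {false} {false} refl = refl

xor-solveʳ : ∀ {a b c} → a xor b ≡ c → b ≡ a xor c
xor-solveʳ {a} {b} eq = xor-solveˡ (trans (Bool.xor-comm b a) eq)

eastHit-xor-westHit : ∀ v p → eastHit v p xor westHit v p ≡ does (v ≟P p)
eastHit-xor-westHit (x , y) (a , b) with b ℤ.≟ y
... | no b≢y rewrite dec-false (y ℤ.≟ b) (b≢y ∘ sym) | Bool.∧-zeroʳ (does (x ℤ.≟ a)) = refl
... | yes refl with x ℤ.≟ a
...   | yes refl rewrite dec-true (x ℤ.≤? x) ℤ.≤-refl | dec-false (x ℤ.<? x) (ℤ.<-irrefl refl)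
                       | dec-true (b ℤ.≟ b) refl = refl
...   | no x≢a = trans (cong (_xor does (x ℤ.<? a)) (does-⇔ ≤⇔< (x ℤ.≤? a) (x ℤ.<? a)))
                         (Bool.xor-same (does (x ℤ.<? a)))
  where
  ≤⇔< : (x ℤ.≤ a) ⇔ (x ℤ.< a)
  ≤⇔< = mk⇔ (λ x≤a → ℤ.≤∧≢⇒< x≤a x≢a) ℤ.<⇒≤

-- Centres on a common row are 4 apart, so no ray from a centre starts strictly between p and p ⊕ (4 , 0).
eastHit≡westHit-shift : ∀ {v p} → IsCenter v → IsCenter p → eastHit v p ≡ westHit v (p ⊕ (+ 4 , + 0))
eastHit≡westHit-shift {x , y} {a , b} cv cp rewrite ℤ.+-identityʳ b with b ℤ.≟ y
... | no _ = refl
... | yes refl = does-⇔ (sameRow-≤⇔< cv cp) (x ℤ.≤? a) (x ℤ.<? a + + 4)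

turn : Side → Side
turn E = N
turn N = W
turn W = S
turn S = E

opp : Side → Side
opp s = turn (turn s)

sidesFrom : Side → List Side
sidesFrom s = s ∷ turn s ∷ opp s ∷ turn (opp s) ∷ []

ccwStart-unit : ∀ t → IsUnit (proj₁ (ccwStart t)) × IsUnit (proj₂ (ccwStart t))
ccwStart-unit N = plus  , plus
ccwStart-unit W = minus , plus
ccwStart-unit S = minus , minus
ccwStart-unit E = plus  , minus

ccwStart-unique : ∀ s → Unique (map ccwStart (sidesFrom s))
ccwStart-unique E = from-yes (unique? (map ccwStart (sidesFrom E)))
ccwStart-unique N = from-yes (unique? (map ccwStart (sidesFrom N)))
ccwStart-unique W = from-yes (unique? (map ccwStart (sidesFrom W)))
ccwStart-unique S = from-yes (unique? (map ccwStart (sidesFrom S)))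

sidesFrom-unique : ∀ s → Unique (sidesFrom s)
sidesFrom-unique s = Unique.map⁻ {f = ccwStart} (ccwStart-unique s)

corner : Cell → Side → Pt
corner c t = cellCentre c ⊕ ccwStart t

corner-injectiveˡ : ∀ {c c′ t t′} → corner c t ≡ corner c′ t′ → c ≡ c′
corner-injectiveˡ {t = t} {t′} eq with ccwStart-unit t | ccwStart-unit t′
... | εx , εy | εx′ , εy′ =
  cong₂ _,_ (4i+ε-injective εx εx′ (cong proj₁ eq)) (4i+ε-injective εy εy′ (cong proj₂ eq))

corners-unique : ∀ c s → Unique (map (corner c) (sidesFrom s))
corners-unique c s = Unique.map⁺ (⊕-cancelˡ (cellCentre c)) (ccwStart-unique s)

across : Side → Cell → Cell
across E (i , j) = (i + + 1 , j)
across N (i , j) = (i , j + + 1)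
across W (i , j) = (i - + 1 , j)
across S (i , j) = (i , j - + 1)

offset : Side → Pt
offset E = (+ 4 , + 0)
offset N = (+ 0 , + 4)
offset W = (- + 4 , + 0)
offset S = (+ 0 , - + 4)

cellCentre-across : ∀ t c → cellCentre (across t c) ≡ cellCentre c ⊕ offset t
cellCentre-across E (i , j) = cong₂ _,_ (ℤ.*-distribˡ-+ (+ 4) i (+ 1)) (sym (ℤ.+-identityʳ _))
cellCentre-across N (i , j) = cong₂ _,_ (sym (ℤ.+-identityʳ _)) (ℤ.*-distribˡ-+ (+ 4) j (+ 1))
cellCentre-across W (i , j) = cong₂ _,_ (ℤ.*-distribˡ-+ (+ 4) i (- + 1)) (sym (ℤ.+-identityʳ _))
cellCentre-across S (i , j) = cong₂ _,_ (sym (ℤ.+-identityʳ _)) (ℤ.*-distribˡ-+ (+ 4) j (- + 1))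

across-opp : ∀ t c → across (opp t) (across t c) ≡ c
across-opp E (i , j) = cong (_, j) (i+1-1≡i i)
across-opp N (i , j) = cong (i ,_) (i+1-1≡i j)
across-opp W (i , j) = cong (_, j) (i-1+1≡i i)
across-opp S (i , j) = cong (i ,_) (i-1+1≡i j)

Adj⇒across : ∀ {u c} → Adj u c → Σ Side λ s → c ≡ across (turn s) u
Adj⇒across         (inj₁ (refl , refl))                = S , refl
Adj⇒across {c = c} (inj₂ (inj₁ (refl , refl)))         = N , sym (across-opp E c)
Adj⇒across         (inj₂ (inj₂ (inj₁ (refl , refl))))  = E , refl
Adj⇒across {c = c} (inj₂ (inj₂ (inj₂ (refl , refl))))  = W , sym (across-opp N c)

across-injective : ∀ t {c c′} → across t c ≡ across t c′ → c ≡ c′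
across-injective t {c} {c′} eq = trans (sym (across-opp t c)) (trans (cong (across (opp t)) eq) (across-opp t c′))

edgeOf : Cell → Side → Edge
edgeOf c E = (cellCentre c , H)
edgeOf c N = (cellCentre c , V)
edgeOf c W = (cellCentre (across W c) , H)
edgeOf c S = (cellCentre (across S c) , V)

ends : Edge → List Pt
ends (v , d) = v ∷ v ⊕ step d ∷ []

edgeOf-ends : ∀ c t → ends (edgeOf c t) ↭ cellCentre c ∷ cellCentre (across t c) ∷ []
edgeOf-ends c E = ↭.↭-reflexive (cong (λ p → cellCentre c ∷ p ∷ []) (sym (cellCentre-across E c)))
edgeOf-ends c N = ↭.↭-reflexive (cong (λ p → cellCentre c ∷ p ∷ []) (sym (cellCentre-across N c)))
edgeOf-ends c W =
  ↭.trans (↭.↭-reflexive (cong (λ p → cellCentre (across W c) ∷ p ∷ []) back)) (↭.swap _ _ ↭.refl)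
  where
  back : cellCentre (across W c) ⊕ step H ≡ cellCentre c
  back = trans (sym (cellCentre-across E (across W c))) (cong cellCentre (across-opp W c))
edgeOf-ends c S =
  ↭.trans (↭.↭-reflexive (cong (λ p → cellCentre (across S c) ∷ p ∷ []) back)) (↭.swap _ _ ↭.refl)
  where
  back : cellCentre (across S c) ⊕ step V ≡ cellCentre c
  back = trans (sym (cellCentre-across N (across S c))) (cong cellCentre (across-opp S c))

edgeOf-opp : ∀ c t → edgeOf (across t c) (opp t) ≡ edgeOf c t
edgeOf-opp c E = cong (λ c → cellCentre c , H) (across-opp E c)
edgeOf-opp c N = cong (λ c → cellCentre c , V) (across-opp N c)
edgeOf-opp c W = refl
edgeOf-opp c S = refl

edgeOf-≡ : ∀ {c c′} t t′ → edgeOf c′ t′ ≡ edgeOf c t →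
           (c′ ≡ c × t′ ≡ t) ⊎ (c′ ≡ across t c × t′ ≡ opp t)
edgeOf-≡ E E eq = inj₁ (cellCentre-injective (cong proj₁ eq) , refl)
edgeOf-≡ N N eq = inj₁ (cellCentre-injective (cong proj₁ eq) , refl)
edgeOf-≡ W W eq = inj₁ (across-injective W (cellCentre-injective (cong proj₁ eq)) , refl)
edgeOf-≡ S S eq = inj₁ (across-injective S (cellCentre-injective (cong proj₁ eq)) , refl)
edgeOf-≡ W E eq = inj₂ (cellCentre-injective (cong proj₁ eq) , refl)
edgeOf-≡ S N eq = inj₂ (cellCentre-injective (cong proj₁ eq) , refl)
edgeOf-≡ {c} {c′} E W eq =
  inj₂ (trans (sym (across-opp W c′)) (cong (across E) (cellCentre-injective (cong proj₁ eq))) , refl)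
edgeOf-≡ {c} {c′} N S eq =
  inj₂ (trans (sym (across-opp S c′)) (cong (across N) (cellCentre-injective (cong proj₁ eq))) , refl)
edgeOf-≡ E N ()
edgeOf-≡ E S ()
edgeOf-≡ N E ()
edgeOf-≡ N W ()
edgeOf-≡ W N ()
edgeOf-≡ W S ()
edgeOf-≡ S E ()
edgeOf-≡ S W ()

Cyclic : {A : Set} → (A → A → Set) → List A → Set
Cyclic R xs = Linked R (xs ++ take 1 xs)

module _ {A : Set} {R : A → A → Set} where

  Linked-split : ∀ xs {y ys} → Linked R (xs ++ y ∷ ys) → Linked R (xs ++ [ y ]) × Linked R (y ∷ ys)
  Linked-split []           l       = [-] , l
  Linked-split (x ∷ [])     (r ∷ l) = r ∷ [-] , l
  Linked-split (x ∷ x′ ∷ xs) (r ∷ l) = let (l₁ , l₂) = Linked-split (x′ ∷ xs) l in r ∷ l₁ , l₂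

  Linked-join : ∀ xs {y ys} → Linked R (xs ++ [ y ]) → Linked R (y ∷ ys) → Linked R (xs ++ y ∷ ys)
  Linked-join []            _             l = l
  Linked-join (x ∷ [])      (r ∷ [-])     l = r ∷ l
  Linked-join (x ∷ x′ ∷ xs) (r ∷ l₁)      l = r ∷ Linked-join (x′ ∷ xs) l₁ l

  Linked-retarget : ∀ xs {y z} → (∀ {x} → R x y → R x z) → Linked R (xs ++ [ y ]) → Linked R (xs ++ [ z ])
  Linked-retarget []            f _         = [-]
  Linked-retarget (x ∷ [])      f (r ∷ [-]) = f r ∷ [-]
  Linked-retarget (x ∷ x′ ∷ xs) f (r ∷ l)   = r ∷ Linked-retarget (x′ ∷ xs) f l

  Cyclic-rotate : ∀ xs ys → Cyclic R (xs ++ ys) → Cyclic R (ys ++ xs)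
  Cyclic-rotate [] ys c = subst (Cyclic R) (sym (List.++-identityʳ ys)) c
  Cyclic-rotate xs [] c = subst (Cyclic R) (List.++-identityʳ xs) c
  Cyclic-rotate (x ∷ xs) (y ∷ ys) c
    with l₁ , l₂ ← Linked-split (x ∷ xs) (subst (Linked R) (List.++-assoc (x ∷ xs) (y ∷ ys) [ x ]) c)
    = subst (Linked R) (sym (List.++-assoc (y ∷ ys) (x ∷ xs) [ y ])) (Linked-join (y ∷ ys) l₂ l₁)

  Cyclic-replaceHead : ∀ {o h} t ys → (∀ {x} → R x o → R x h) →
                       (∀ {y} → R o y → Linked R (h ∷ t ++ [ y ])) →
                       Cyclic R (o ∷ ys) → Cyclic R (h ∷ t ++ ys)
  Cyclic-replaceHead {h = h} t [] enter leave (r ∷ [-]) =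
    subst (λ zs → Linked R (h ∷ zs ++ [ h ])) (sym (List.++-identityʳ t)) (Linked-retarget (h ∷ t) enter (leave r))
  Cyclic-replaceHead {h = h} t (y ∷ ys) enter leave (r ∷ l) =
    subst (Linked R) (sym (List.++-assoc (h ∷ t) (y ∷ ys) [ h ]))
      (Linked-join (h ∷ t) (leave r) (Linked-retarget (y ∷ ys) enter l))

module _ {A : Set} where

  Unique-++-disjoint : ∀ (xs : List A) {ys y} → Unique (xs ++ ys) → y ∈ ys → y ∉ xs
  Unique-++-disjoint (x ∷ xs) (x∉ ∷ _) y∈ys (here refl) = All.lookup x∉ (∈-++⁺ʳ xs y∈ys) refl
  Unique-++-disjoint (x ∷ xs) (_ ∷ u)  y∈ys (there y∈xs) = Unique-++-disjoint xs u y∈ys y∈xs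

  Unique-insert : ∀ {x : A} xs {ys} → Unique (x ∷ ys) → Unique xs → (∀ {z} → z ∈ xs → z ∉ x ∷ ys) →
                  Unique (x ∷ xs ++ ys)
  Unique-insert xs (x∉ys ∷ uys) uxs fresh =
    All.++⁺ (All.tabulate (λ z∈xs x≡z → fresh z∈xs (here (sym x≡z)))) x∉ys
    ∷ Unique.++⁺ uxs uys (λ (z∈xs , z∈ys) → fresh z∈xs (there z∈ys))

-- The detour around a new cell

kissing-isCenter : ∀ c t → IsCenter (cellCentre c ⊕ double (ccwStart t))
kissing-isCenter (i , j) N = i , j , inj₂ (refl , refl)
kissing-isCenter (i , j) W = i - + 1 , j , inj₂ (4i-2≡4[i-1]+2 i , refl)
kissing-isCenter (i , j) S = i - + 1 , j - + 1 , inj₂ (4i-2≡4[i-1]+2 i , 4i-2≡4[i-1]+2 j)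
kissing-isCenter (i , j) E = i , j - + 1 , inj₂ (refl , 4i-2≡4[i-1]+2 j)

cellCentre≢kissing : ∀ c c′ t → cellCentre c′ ≢ cellCentre c ⊕ double (ccwStart t)
cellCentre≢kissing (i , _) (i′ , _) N eq = 4i≢4j+2 i′ i (cong proj₁ eq)
cellCentre≢kissing (i , _) (i′ , _) E eq = 4i≢4j+2 i′ i (cong proj₁ eq)
cellCentre≢kissing (i , _) (i′ , _) W eq =
  4i≢4j+2 i i′ (trans (sym (4i-2+2≡4i i)) (cong (_+ + 2) (sym (cong proj₁ eq))))
cellCentre≢kissing (i , _) (i′ , _) S eq =
  4i≢4j+2 i i′ (trans (sym (4i-2+2≡4i i)) (cong (_+ + 2) (sym (cong proj₁ eq))))

ccwNext : ∀ p t → Follows (olink p t ccw) (olink p (turn t) ccw)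
ccwNext p E = refl , refl
ccwNext p N = refl , refl
ccwNext p W = refl , refl
ccwNext p S = refl , refl

-- p ⊕ double (ccwStart t) is the centre of the circle touching the circle of p at p ⊕ ccwStart t.
kissIn : ∀ p t → Follows (olink (p ⊕ double (ccwStart t)) (opp t) cw) (olink p t ccw)
kissIn p E = ⊕-assoc p _ _ , refl
kissIn p N = ⊕-assoc p _ _ , refl
kissIn p W = ⊕-assoc p _ _ , refl
kissIn p S = ⊕-assoc p _ _ , refl

kissOut : ∀ p t → Follows (olink p t ccw) (olink (p ⊕ double (ccwStart (turn t))) (opp t) cw)
kissOut p E = sym (⊕-assoc p _ _) , refl
kissOut p N = sym (⊕-assoc p _ _) , refl
kissOut p W = sym (⊕-assoc p _ _) , refl
kissOut p S = sym (⊕-assoc p _ _) , refl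

enterArc exitArc : Side → Pt → OLink
enterArc s p = olink (p ⊕ double (ccwStart s)) (opp s) cw
exitArc  s p = olink (p ⊕ double (ccwStart (turn (opp s)))) (opp (opp s)) cw

detourTail : Side → Pt → List OLink
detourTail s p = olink p s ccw ∷ olink p (turn s) ccw ∷ olink p (opp s) ccw ∷ exitArc s p ∷ []

-- The detour around the cell of centre p attached through its side turn (opp s).
detour : Side → Pt → List OLink
detour s p = enterArc s p ∷ detourTail s p

enterArc-start : ∀ s q → startPt (enterArc s (q ⊕ offset (turn s))) ≡ startPt (olink q (turn s) ccw)
                        × startTan (enterArc s (q ⊕ offset (turn s))) ≡ startTan (olink q (turn s) ccw)
enterArc-start E q = ⊕-assoc₃ q (offset N) (double (ccwStart E)) (ccwEnd W) , refl
enterArc-start N q = ⊕-assoc₃ q (offset W) (double (ccwStart N)) (ccwEnd S) , refl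
enterArc-start W q = ⊕-assoc₃ q (offset S) (double (ccwStart W)) (ccwEnd E) , refl
enterArc-start S q = ⊕-assoc₃ q (offset E) (double (ccwStart S)) (ccwEnd N) , refl

exitArc-end : ∀ s q → endPt (exitArc s (q ⊕ offset (turn s))) ≡ endPt (olink q (turn s) ccw)
                     × endTan (exitArc s (q ⊕ offset (turn s))) ≡ endTan (olink q (turn s) ccw)
exitArc-end E q = ⊕-assoc₃ q (offset N) (double (ccwStart S)) (ccwStart E) , refl
exitArc-end N q = ⊕-assoc₃ q (offset W) (double (ccwStart E)) (ccwStart N) , refl
exitArc-end W q = ⊕-assoc₃ q (offset S) (double (ccwStart N)) (ccwStart W) , refl
exitArc-end S q = ⊕-assoc₃ q (offset E) (double (ccwStart W)) (ccwStart S) , refl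

exitArc-start : ∀ s p → startPt (exitArc s p) ≡ p ⊕ ccwStart (turn (opp s))
exitArc-start E p = ⊕-assoc p _ _
exitArc-start N p = ⊕-assoc p _ _
exitArc-start W p = ⊕-assoc p _ _
exitArc-start S p = ⊕-assoc p _ _

detour-enter : ∀ s q {x} → Follows x (olink q (turn s) ccw) → Follows x (enterArc s (q ⊕ offset (turn s)))
detour-enter s q (pt , tan) = let (pt′ , tan′) = enterArc-start s q in trans pt (sym pt′) , trans tan (sym tan′)

detour-leave : ∀ s q {y} → Follows (olink q (turn s) ccw) y →
               Linked Follows (detour s (q ⊕ offset (turn s)) ++ [ y ])
detour-leave s q (pt , tan) =
  kissIn p s ∷ ccwNext p s ∷ ccwNext p (turn s) ∷ kissOut p (opp s) ∷ (trans pt′ pt , trans tan′ tan) ∷ [-]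
  where
  p = q ⊕ offset (turn s)
  pt′ = proj₁ (exitArc-end s q)
  tan′ = proj₂ (exitArc-end s q)

detour-centres : ∀ s c → All (λ l → IsCenter (center l)) (detour s (cellCentre c))
detour-centres s c =
  kissing-isCenter c s ∷ cellCentre-isCenter c ∷ cellCentre-isCenter c ∷ cellCentre-isCenter c
  ∷ kissing-isCenter c (turn (opp s)) ∷ []

detour-startPts : ∀ s c → map startPt (detour s (cellCentre c))
                        ≡ startPt (enterArc s (cellCentre c)) ∷ map (corner c) (sidesFrom s)
detour-startPts s c =
  cong (λ x → startPt (enterArc s (cellCentre c)) ∷ corner c s ∷ corner c (turn s) ∷ corner c (opp s) ∷ [ x ])
       (exitArc-start s (cellCentre c))

detour-covers : ∀ s t p → olink p t ccw ∈ detour s p ⊎ t ≡ turn (opp s)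
detour-covers E E p = inj₁ (there (here refl))
detour-covers E N p = inj₁ (there (there (here refl)))
detour-covers E W p = inj₁ (there (there (there (here refl))))
detour-covers E S p = inj₂ refl
detour-covers N N p = inj₁ (there (here refl))
detour-covers N W p = inj₁ (there (there (here refl)))
detour-covers N S p = inj₁ (there (there (there (here refl))))
detour-covers N E p = inj₂ refl
detour-covers W W p = inj₁ (there (here refl))
detour-covers W S p = inj₁ (there (there (here refl)))
detour-covers W E p = inj₁ (there (there (there (here refl))))
detour-covers W N p = inj₂ refl
detour-covers S S p = inj₁ (there (here refl))
detour-covers S E p = inj₁ (there (there (here refl)))
detour-covers S N p = inj₁ (there (there (there (here refl))))
detour-covers S W p = inj₂ refl

detour-cellLink : ∀ s c {c′ t o} → olink (cellCentre c′) t o ∈ detour s (cellCentre c) →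
                  o ≡ ccw × c′ ≡ c × t ≢ turn (opp s)
detour-cellLink s c mem with sidesFrom-unique s
... | (_ ∷ _ ∷ s≢back ∷ []) ∷ (_ ∷ turn≢back ∷ []) ∷ (opp≢back ∷ []) ∷ _ = go mem
  where
  own : ∀ {c′ t o t₀} → olink (cellCentre c′) t o ≡ olink (cellCentre c) t₀ ccw → t₀ ≢ turn (opp s) →
        o ≡ ccw × c′ ≡ c × t ≢ turn (opp s)
  own eq t₀≢back = cong orient eq , cellCentre-injective (cong center eq) , t₀≢back ∘ trans (sym (cong side eq))
  go : ∀ {c′ t o} → olink (cellCentre c′) t o ∈ detour s (cellCentre c) →
       o ≡ ccw × c′ ≡ c × t ≢ turn (opp s)
  go (here eq)                                 = ⊥-elim (cellCentre≢kissing c _ s (cong center eq))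
  go (there (here eq))                         = own eq s≢back
  go (there (there (here eq)))                 = own eq turn≢back
  go (there (there (there (here eq))))         = own eq opp≢back
  go (there (there (there (there (here eq))))) = ⊥-elim (cellCentre≢kissing c _ (turn (opp s)) (cong center eq))

-- The two touching arcs are crossed together (eastHit≡westHit-shift), so only the crossing at c changes.
detour-parity : ∀ s u {v} → IsCenter v →
                crossParity v (detour s (cellCentre (across (turn s) u)))
                  ≡ crosses v (olink (cellCentre u) (turn s) ccw) xor does (v ≟P cellCentre (across (turn s) u))
detour-parity S u {v} cv = begin
  eastHit v p xor false
    ≡⟨ Bool.xor-identityʳ _ ⟩
  eastHit v p
    ≡⟨ xor-solveˡ (eastHit-xor-westHit v p) ⟩
  westHit v p xor does (v ≟P p)
    ≡⟨ cong (λ r → westHit v r xor does (v ≟P p)) (cellCentre-across E u) ⟩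
  westHit v (q ⊕ offset E) xor does (v ≟P p)
    ≡⟨ cong (_xor does (v ≟P p)) (eastHit≡westHit-shift cv (cellCentre-isCenter u)) ⟨
  eastHit v q xor does (v ≟P p) ∎
  where
  open ≡-Reasoning
  p q : Pt
  p = cellCentre (across E u)
  q = cellCentre u
detour-parity N u {v} cv = begin
  westHit v p xor false
    ≡⟨ Bool.xor-identityʳ _ ⟩
  westHit v p
    ≡⟨ xor-solveʳ {eastHit v p} (eastHit-xor-westHit v p) ⟩
  eastHit v p xor does (v ≟P p)
    ≡⟨ cong (_xor does (v ≟P p)) (eastHit≡westHit-shift cv (cellCentre-isCenter (across W u))) ⟩
  westHit v (p ⊕ offset E) xor does (v ≟P p)
    ≡⟨ cong (λ r → westHit v r xor does (v ≟P p)) p⊕E≡q ⟩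
  westHit v q xor does (v ≟P p) ∎
  where
  open ≡-Reasoning
  p q : Pt
  p = cellCentre (across W u)
  q = cellCentre u
  p⊕E≡q : p ⊕ offset E ≡ q
  p⊕E≡q = trans (sym (cellCentre-across E (across W u))) (cong cellCentre (across-opp W u))
detour-parity E u {v} cv = begin
  westHit v k₁ xor (eastHit v p xor (westHit v p xor (eastHit v k₂ xor false)))
    ≡⟨ cong (λ b → westHit v k₁ xor (eastHit v p xor (westHit v p xor (b xor false)))) k₂-east ⟩
  westHit v k₁ xor (eastHit v p xor (westHit v p xor (westHit v k₁ xor false)))
    ≡⟨ cong (westHit v k₁ xor_) (Bool.xor-assoc (eastHit v p) _ _) ⟨
  westHit v k₁ xor ((eastHit v p xor westHit v p) xor (westHit v k₁ xor false))
    ≡⟨ xor-sandwich (westHit v k₁) _ ⟩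
  eastHit v p xor westHit v p
    ≡⟨ eastHit-xor-westHit v p ⟩
  does (v ≟P p) ∎
  where
  open ≡-Reasoning
  p k₁ k₂ : Pt
  p = cellCentre (across N u)
  k₁ = p ⊕ double (ccwStart E)
  k₂ = p ⊕ double (ccwStart S)
  k₂-east : eastHit v k₂ ≡ westHit v k₁
  k₂-east = trans (eastHit≡westHit-shift cv (kissing-isCenter (across N u) S))
                  (cong (westHit v) (⊕-assoc p _ (offset E)))
detour-parity W u {v} cv = begin
  eastHit v k₁ xor (westHit v p xor (eastHit v p xor (westHit v k₂ xor false)))
    ≡⟨ cong (_xor (westHit v p xor (eastHit v p xor (westHit v k₂ xor false)))) k₁-east ⟩
  westHit v k₂ xor (westHit v p xor (eastHit v p xor (westHit v k₂ xor false)))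
    ≡⟨ cong (westHit v k₂ xor_) (Bool.xor-assoc (westHit v p) _ _) ⟨
  westHit v k₂ xor ((westHit v p xor eastHit v p) xor (westHit v k₂ xor false))
    ≡⟨ xor-sandwich (westHit v k₂) _ ⟩
  westHit v p xor eastHit v p
    ≡⟨ Bool.xor-comm (westHit v p) _ ⟩
  eastHit v p xor westHit v p
    ≡⟨ eastHit-xor-westHit v p ⟩
  does (v ≟P p) ∎
  where
  open ≡-Reasoning
  p k₁ k₂ : Pt
  p = cellCentre (across S u)
  k₁ = p ⊕ double (ccwStart W)
  k₂ = p ⊕ double (ccwStart N)
  k₁-east : eastHit v k₁ ≡ westHit v k₂
  k₁-east = trans (eastHit≡westHit-shift cv (kissing-isCenter (across S u) W))
                  (cong (westHit v) (⊕-assoc p _ (offset E)))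

-- Tangles around a tree of cells

CornerOf : List Cell → Pt → Set
CornerOf Q x = Σ Cell λ c → c ∈ Q × Σ Side λ t → x ≡ corner c t

-- L is a tangle enclosing exactly the centres of the cells of Q, and es lists the edges of its dual graph.
record TreeTangle (Q : List Cell) (es : List Edge) (L : List OLink) : Set where
  field
    centres      : All (λ l → IsCenter (center l)) L
    cyclic       : Cyclic Follows L
    startsUnique : Unique (map startPt L)
    cornered     : All (CornerOf Q ∘ startPt) L
    parity       : ∀ v → IsCenter v → crossParity v L ≡ does (v ∈? map cellCentre Q)
    cellLink     : ∀ {c t o} → olink (cellCentre c) t o ∈ L → o ≡ ccw × c ∈ Q × edgeOf c t ∉ es
    sideCovered  : ∀ {c} t → c ∈ Q → olink (cellCentre c) t ccw ∈ L ⊎ edgeOf c t ∈ es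
    someCellLink : Σ Cell λ c → Σ Side λ t → olink (cellCentre c) t ccw ∈ L
    treeUnique   : Unique es
    treeSize     : suc (length es) ≡ length Q
    treeEnds     : All (λ e → All (_∈ map cellCentre Q) (ends e)) es

circle : Pt → List OLink
circle p = map (λ t → olink p t ccw) (sidesFrom E)

circle-covers : ∀ p t → olink p t ccw ∈ circle p
circle-covers p E = here refl
circle-covers p N = there (here refl)
circle-covers p W = there (there (here refl))
circle-covers p S = there (there (there (here refl)))

singleton : ∀ c → TreeTangle [ c ] [] (circle (cellCentre c))
singleton c = record
  { centres      = isC ∷ isC ∷ isC ∷ isC ∷ []
  ; cyclic       = ccwNext p E ∷ ccwNext p N ∷ ccwNext p W ∷ ccwNext p S ∷ [-]
  ; startsUnique = corners-unique c E
  ; cornered     = own E ∷ own N ∷ own W ∷ own S ∷ []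
  ; parity       = λ v _ → trans (cong (eastHit v p xor_) (Bool.xor-identityʳ _))
                                 (trans (eastHit-xor-westHit v p) (sym (∈?-single v p)))
  ; cellLink     = link
  ; sideCovered  = λ { t (here refl) → inj₁ (circle-covers p t) }
  ; someCellLink = c , E , here refl
  ; treeUnique   = []
  ; treeSize     = refl
  ; treeEnds     = []
  }
  where
  p = cellCentre c
  isC = cellCentre-isCenter c
  own : ∀ t → CornerOf [ c ] (corner c t)
  own t = c , here refl , t , refl
  link : ∀ {c′ t o} → olink (cellCentre c′) t o ∈ circle p → o ≡ ccw × c′ ∈ [ c ] × edgeOf c′ t ∉ []
  link m with _ , _ , eq ← ∈-map⁻ (λ t → olink p t ccw) m =
    cong orient eq , here (cellCentre-injective (cong center eq)) , λ ()

unique-↭ : ∀ {xs ys : List Pt} → xs ↭ ys → Unique xs → Unique ys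
unique-↭ p = PermPt.Unique-resp-↭ (↭.↭⇒↭ₛ p)

TreeTangle-↭ : ∀ {Q es L L′} → L ↭ L′ → Cyclic Follows L′ → TreeTangle Q es L → TreeTangle Q es L′
TreeTangle-↭ L↭L′ cyclic′ T = record
  { centres      = All-resp-↭ L↭L′ centres
  ; cyclic       = cyclic′
  ; startsUnique = unique-↭ (↭.map⁺ startPt L↭L′) startsUnique
  ; cornered     = All-resp-↭ L↭L′ cornered
  ; parity       = λ v cv → trans (sym (crossParity-↭ v L↭L′)) (parity v cv)
  ; cellLink     = cellLink ∘ ∈-resp-↭ (↭.↭-sym L↭L′)
  ; sideCovered  = λ t c∈Q → Sum.map₁ (∈-resp-↭ L↭L′) (sideCovered t c∈Q)
  ; someCellLink = let (c , t , m) = someCellLink in c , t , ∈-resp-↭ L↭L′ m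
  ; treeUnique   = treeUnique
  ; treeSize     = treeSize
  ; treeEnds     = treeEnds
  }
  where open TreeTangle T

TreeTangle-rotate : ∀ {Q es} xs ys → TreeTangle Q es (xs ++ ys) → TreeTangle Q es (ys ++ xs)
TreeTangle-rotate xs ys T = TreeTangle-↭ (↭.++-comm xs ys) (Cyclic-rotate xs ys (TreeTangle.cyclic T)) T

edgeOf-from-outside : ∀ {Q es L c} t → TreeTangle Q es L → c ∉ Q → edgeOf c t ∉ es
edgeOf-from-outside {c = c} t T c∉Q e∈es
  with c∈ ∷ _ ← All-resp-↭ (edgeOf-ends c t) (All.lookup (TreeTangle.treeEnds T) e∈es)
  = c∉Q (cellCentre-∈ c∈)

edgeOf-to-outside : ∀ {Q es L u} t → TreeTangle Q es L → across t u ∉ Q → edgeOf u t ∉ es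
edgeOf-to-outside {u = u} t T c∉Q = subst (_∉ _) (edgeOf-opp u t) (edgeOf-from-outside (opp t) T c∉Q)

-- The arc of u on its side turn s is replaced by the detour around the cell c across that side.
module Attach (s : Side) {Q es zs u} (T : TreeTangle Q es (olink (cellCentre u) (turn s) ccw ∷ zs))
              (u∈Q : u ∈ Q) (c∉Q : across (turn s) u ∉ Q) where
  open TreeTangle T

  c : Cell
  c = across (turn s) u

  o : OLink
  o = olink (cellCentre u) (turn s) ccw

  p : Pt
  p = cellCentre c

  o∉zs : o ∉ zs
  o∉zs o∈zs with startO∉ ∷ _ ← startsUnique = All.lookup startO∉ (∈-map⁺ startPt o∈zs) refl

  enter-start : startPt (enterArc s p) ≡ startPt o
  enter-start = subst (λ x → startPt (enterArc s x) ≡ startPt o) (sym (cellCentre-across (turn s) u))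
                      (proj₁ (enterArc-start s (cellCentre u)))

  cyclic′ : Cyclic Follows (detour s p ++ zs)
  cyclic′ = subst (λ x → Cyclic Follows (detour s x ++ zs)) (sym (cellCentre-across (turn s) u))
                  (Cyclic-replaceHead (detourTail s (q ⊕ offset (turn s))) zs
                                      (detour-enter s q) (detour-leave s q) cyclic)
    where
    q = cellCentre u

  startsUnique′ : Unique (map startPt (detour s p ++ zs))
  startsUnique′ = subst Unique (sym starts) (Unique-insert corners startsUnique (corners-unique c s) fresh)
    where
    corners = map (corner c) (sidesFrom s)
    starts : map startPt (detour s p ++ zs) ≡ startPt o ∷ corners ++ map startPt zs
    starts = trans (List.map-++ startPt (detour s p) zs)
                   (cong (_++ map startPt zs) (trans (detour-startPts s c) (cong (_∷ corners) enter-start)))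
    fresh : ∀ {z} → z ∈ corners → z ∉ map startPt (o ∷ zs)
    fresh z∈ z∈old with t , _ , refl ← ∈-map⁻ (corner c) {xs = sidesFrom s} z∈
                     | l , l∈ , eq ← ∈-map⁻ startPt {xs = o ∷ zs} z∈old
      with c′ , c′∈Q , t′ , eq′ ← All.lookup cornered l∈
      = c∉Q (subst (_∈ Q) (sym (corner-injectiveˡ {c} {c′} {t} {t′} (trans eq eq′))) c′∈Q)

  cornered′ : All (CornerOf (c ∷ Q) ∘ startPt) (detour s p ++ zs)
  cornered′ = All.++⁺ (enter ∷ own s ∷ own (turn s) ∷ own (opp s) ∷ exit ∷ [])
                      (All.map weaken (All.tail cornered))
    where
    weaken : ∀ {x} → CornerOf Q x → CornerOf (c ∷ Q) x
    weaken (c′ , c′∈Q , t , eq) = c′ , there c′∈Q , t , eq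
    enter : CornerOf (c ∷ Q) (startPt (enterArc s p))
    enter = weaken (subst (CornerOf Q) (sym enter-start) (All.head cornered))
    own : ∀ t → CornerOf (c ∷ Q) (corner c t)
    own t = c , here refl , t , refl
    exit : CornerOf (c ∷ Q) (startPt (exitArc s p))
    exit = c , here refl , turn (opp s) , exitArc-start s p

  parity′ : ∀ v → IsCenter v → crossParity v (detour s p ++ zs) ≡ does (v ∈? p ∷ map cellCentre Q)
  parity′ v cv = begin
    crossParity v (detour s p ++ zs)                          ≡⟨ crossParity-++ v (detour s p) zs ⟩
    crossParity v (detour s p) xor crossParity v zs           ≡⟨ cong (_xor crossParity v zs) (detour-parity s u cv) ⟩
    (crosses v o xor does (v ≟P p)) xor crossParity v zs      ≡⟨ xor-exchange (crosses v o) _ _ ⟩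
    (crosses v o xor crossParity v zs) xor does (v ≟P p)      ≡⟨ cong (_xor does (v ≟P p)) (parity v cv) ⟩
    does (v ∈? map cellCentre Q) xor does (v ≟P p)            ≡⟨ ∈?-fresh v (c∉Q ∘ cellCentre-∈) ⟨
    does (v ∈? p ∷ map cellCentre Q)                          ∎
    where
    open ≡-Reasoning
    xor-exchange : ∀ a b d → (a xor b) xor d ≡ (a xor d) xor b
    xor-exchange a b d = trans (Bool.xor-assoc a b d)
                           (trans (cong (a xor_) (Bool.xor-comm b d)) (sym (Bool.xor-assoc a d b)))

  newLink : ∀ {t} → t ≢ turn (opp s) → edgeOf c t ∉ edgeOf u (turn s) ∷ es
  newLink {t} t≢back (here eq) with edgeOf-≡ (turn s) t eq
  ... | inj₁ (c≡u , _) = c∉Q (subst (_∈ Q) (sym c≡u) u∈Q)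
  ... | inj₂ (_ , t≡back) = t≢back t≡back
  newLink {t} _ (there e) = edgeOf-from-outside t T c∉Q e

  oldLink : ∀ {c′ t o′} → olink (cellCentre c′) t o′ ∈ zs → o′ ≡ ccw → c′ ∈ Q → edgeOf c′ t ∉ es →
            edgeOf c′ t ∉ edgeOf u (turn s) ∷ es
  oldLink {t = t} l∈zs refl c′∈Q _ (here eq) with edgeOf-≡ (turn s) t eq
  ... | inj₁ (refl , refl) = o∉zs l∈zs
  ... | inj₂ (refl , _)    = c∉Q c′∈Q
  oldLink _ _ _ e∉es (there e) = e∉es e

  cellLink′ : ∀ {c′ t o′} → olink (cellCentre c′) t o′ ∈ detour s p ++ zs →
              o′ ≡ ccw × c′ ∈ c ∷ Q × edgeOf c′ t ∉ edgeOf u (turn s) ∷ es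
  cellLink′ m with ∈-++⁻ (detour s p) m
  ... | inj₁ m₁ with o′≡ccw , refl , t≢back ← detour-cellLink s c m₁ =
    o′≡ccw , here refl , newLink t≢back
  ... | inj₂ m₂ with o′≡ccw , c′∈Q , e∉es ← cellLink (there m₂) =
    o′≡ccw , there c′∈Q , oldLink m₂ o′≡ccw c′∈Q e∉es

  sideCovered′ : ∀ {c′} t → c′ ∈ c ∷ Q →
                 olink (cellCentre c′) t ccw ∈ detour s p ++ zs ⊎ edgeOf c′ t ∈ edgeOf u (turn s) ∷ es
  sideCovered′ t (here refl) with detour-covers s t p
  ... | inj₁ m    = inj₁ (∈-++⁺ˡ m)
  ... | inj₂ refl = inj₂ (here (edgeOf-opp u (turn s)))
  sideCovered′ t (there c′∈Q) with sideCovered t c′∈Q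
  ... | inj₁ (here eq)  = inj₂ (here (cong₂ edgeOf (cellCentre-injective (cong center eq)) (cong side eq)))
  ... | inj₁ (there m)  = inj₁ (∈-++⁺ʳ (detour s p) m)
  ... | inj₂ e          = inj₂ (there e)

  tangle : TreeTangle (c ∷ Q) (edgeOf u (turn s) ∷ es) (detour s p ++ zs)
  tangle = record
    { centres      = All.++⁺ (detour-centres s c) (All.tail centres)
    ; cyclic       = cyclic′
    ; startsUnique = startsUnique′
    ; cornered     = cornered′
    ; parity       = parity′
    ; cellLink     = cellLink′
    ; sideCovered  = sideCovered′
    ; someCellLink = c , s , ∈-++⁺ˡ {xs = detour s p} (there (here refl))
    ; treeUnique   = All.¬Any⇒All¬ es (edgeOf-to-outside (turn s) T c∉Q) ∷ treeUnique
    ; treeSize     = cong suc treeSize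
    ; treeEnds     = All-resp-↭ (↭.↭-sym (edgeOf-ends u (turn s))) (there (∈-map⁺ cellCentre u∈Q) ∷ here refl ∷ [])
                     ∷ All.map (All.map there) treeEnds
    }

GrownTangle : List Cell → Set
GrownTangle Q = Σ (List Edge) λ es → Σ (List OLink) λ L → TreeTangle Q es L

extend : ∀ {Q u c} → GrownTangle Q → u ∈ Q → c ∉ Q → Adj u c → GrownTangle (c ∷ Q)
extend (_ , _ , T) u∈Q c∉Q adj with s , refl ← Adj⇒across adj with TreeTangle.sideCovered T (turn s) u∈Q
... | inj₂ e∈es = ⊥-elim (edgeOf-to-outside (turn s) T c∉Q e∈es)
... | inj₁ o∈L with xs , ys , refl ← ∈-∃++ o∈L =
  _ , _ , Attach.tangle s (TreeTangle-rotate xs (olink _ (turn s) ccw ∷ ys) T) u∈Q c∉Q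

-- Growing a connected set of cells one neighbour at a time

Conn-head : ∀ {S a b} → Conn S a b → S a
Conn-head (here Sa)     = Sa
Conn-head (next Sa _ _) = Sa

Conn-exit : ∀ {S a b} Q → Conn S a b → a ∈ Q → b ∉ Q →
            Σ Cell λ u → Σ Cell λ c → u ∈ Q × c ∉ Q × S c × Adj u c
Conn-exit Q (here _) a∈Q b∉Q = ⊥-elim (b∉Q a∈Q)
Conn-exit Q (next {a} {b} _ adj path) a∈Q c∉Q with b ∈? Q
... | yes b∈Q = Conn-exit Q path b∈Q c∉Q
... | no  b∉Q = a , b , a∈Q , b∉Q , Conn-head path , adj

module Growth (Φ : List Cell → Set) (grow₁ : ∀ {Q u c} → Φ Q → u ∈ Q → c ∉ Q → Adj u c → Φ (c ∷ Q))
              {P : List Cell} (P-unique : Unique P) (P-conn : ∀ a b → a ∈ P → b ∈ P → Conn (_∈ P) a b) where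

  unadded : ∀ {Q R r} → Q ++ R ↭ P → r ∈ R → r ∉ Q
  unadded QR↭P = Unique-++-disjoint _ (unique-↭ (↭.↭-sym QR↭P) P-unique)

  pending : ∀ {Q R c} → Q ++ R ↭ P → c ∈ P → c ∉ Q → c ∈ R
  pending {Q} QR↭P c∈P c∉Q = Sum.[ ⊥-elim ∘ c∉Q , id ]′ (∈-++⁻ Q (∈-resp-↭ (↭.↭-sym QR↭P) c∈P))

  frontier : ∀ {Q R q r} → q ∈ Q → r ∈ R → Q ++ R ↭ P →
             Σ Cell λ u → Σ Cell λ c → u ∈ Q × c ∉ Q × c ∈ R × Adj u c
  frontier {Q} {R} {q} {r} q∈Q r∈R QR↭P
    with path ← P-conn q r (∈-resp-↭ QR↭P (∈-++⁺ˡ q∈Q)) (∈-resp-↭ QR↭P (∈-++⁺ʳ Q r∈R))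
    with u , c , u∈Q , c∉Q , c∈P , adj ← Conn-exit Q path q∈Q (unadded QR↭P r∈R)
    = u , c , u∈Q , c∉Q , pending QR↭P c∈P c∉Q , adj

  transfer : ∀ {Q R c} → c ∈ R → Q ++ R ↭ P →
             Σ (List Cell) λ R′ → suc (length R′) ≡ length R × (c ∷ Q) ++ R′ ↭ P
  transfer {Q} {c = c} c∈R QR↭P with R₁ , R₂ , refl ← ∈-∃++ c∈R =
    R₁ ++ R₂ , sym (↭.↭-length (↭.shift c R₁ R₂)) ,
    ↭.trans (↭.↭-sym (↭.shift c Q (R₁ ++ R₂)))
            (↭.trans (↭.++⁺ˡ Q (↭.↭-sym (↭.shift c R₁ R₂))) QR↭P)

  -- R lists the cells still to be added; recursion is on its length.
  grow : ∀ n {Q R q} → length R ≡ n → q ∈ Q → Q ++ R ↭ P → Φ Q → Σ (List Cell) λ Q′ → Q′ ↭ P × Φ Q′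
  grow zero    {Q} {[]}    _   _   QR↭P φ = Q , subst (_↭ P) (List.++-identityʳ Q) QR↭P , φ
  grow zero    {R = _ ∷ _} ()
  grow (suc n) {R = []}    ()
  grow (suc n) {Q} {r ∷ R} len q∈Q QR↭P φ
    with u , c , u∈Q , c∉Q , c∈R , adj ← frontier q∈Q (here refl) QR↭P
    with R′ , len′ , perm ← transfer c∈R QR↭P
    = grow n (ℕ.suc-injective (trans len′ len)) (there q∈Q) perm (grow₁ φ u∈Q c∉Q adj)

spanning : (Φ : List Cell → Set) → (∀ {Q u c} → Φ Q → u ∈ Q → c ∉ Q → Adj u c → Φ (c ∷ Q)) →
           ∀ {p ps} → IsPolyomino (p ∷ ps) → Φ [ p ] → Σ (List Cell) λ Q → Q ↭ p ∷ ps × Φ Q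
spanning Φ grow₁ {ps = ps} (P-unique , P-conn) =
  Growth.grow Φ grow₁ P-unique P-conn (length ps) refl (here refl) ↭.refl

-- Reading off the tangle, its dual graph and its Chan polyomino

bit≡1⇒ : ∀ {A : Set} (a? : Dec A) → bit (does a?) ≡ 1 → A
bit≡1⇒ (yes a) _ = a

forward : Dir → Side
forward H = E
forward V = N

edgeOf-forward : ∀ c dd → edgeOf c (forward dd) ≡ (cellCentre c , dd)
edgeOf-forward c H = refl
edgeOf-forward c V = refl

cellCentre-step : ∀ c dd → cellCentre c ⊕ step dd ≡ cellCentre (across (forward dd) c)
cellCentre-step c H = sym (cellCentre-across E c)
cellCentre-step c V = sym (cellCentre-across N c)

module ReadOff {Q es L} (T : TreeTangle Q es L) where
  open TreeTangle T

  tangle : Tangle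
  tangle = record
    { links = L ; centers = centres ; closed = cyclic ; simple = startsUnique
    ; nonempty = ∈-length (proj₂ (proj₂ someCellLink)) }

  inside⇒ : ∀ {v} → Inside tangle v → v ∈ map cellCentre Q
  inside⇒ {v} (cv , odd) =
    bit≡1⇒ (v ∈? map cellCentre Q)
           (trans (sym (cong bit (parity v cv))) (trans (sym (rayCount-parity v L)) odd))

  inside⇐ : ∀ {v} → v ∈ map cellCentre Q → Inside tangle v
  inside⇐ {v} v∈ with c , _ , refl ← ∈-map⁻ cellCentre v∈ =
    cellCentre-isCenter c ,
    trans (rayCount-parity v L) (cong bit (trans (parity v (cellCentre-isCenter c)) (dec-true (v ∈? _) v∈)))

  dualVertex⇐ : ∀ {v} → v ∈ map cellCentre Q → DualVertex tangle v
  dualVertex⇐ {v} v∈ with c , _ , refl ← ∈-map⁻ cellCentre v∈ | c₀ , t₀ , l∈L ← someCellLink =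
    inside⇐ v∈ , lose l∈L (inside⇐ (∈-map⁺ cellCentre (proj₁ (proj₂ (cellLink l∈L)))) , sameLattice)
    where
    sameLattice : SameLattice (cellCentre c) (cellCentre c₀)
    sameLattice = _ , _ , 4i≡4j+4[i-j] (proj₁ c) (proj₁ c₀) , 4i≡4j+4[i-j] (proj₂ c) (proj₂ c₀)

  hasLink⇒ : ∀ {w t} → HasLink tangle w t → Σ Orient λ o → olink w t o ∈ L
  hasLink⇒ h with l , l∈L , refl , refl ← find h = orient l , l∈L

  edge⇒ : ∀ {v dd} → (v , dd) ∈ es → DualVertex tangle v × DualVertex tangle (v ⊕ step dd) ×
          ¬ (HasLink tangle v (forward dd) ⊎ HasLink tangle (v ⊕ step dd) (opp (forward dd)))
  edge⇒ {v} {dd} e∈es with v∈ ∷ w∈ ∷ [] ← All.lookup treeEnds e∈es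
    with c₁ , _ , refl ← ∈-map⁻ cellCentre v∈ | c₂ , _ , w≡ ← ∈-map⁻ cellCentre w∈
    = dualVertex⇐ v∈ , dualVertex⇐ w∈ , Sum.[ near , far ]′
    where
    near : ¬ HasLink tangle (cellCentre c₁) (forward dd)
    near h with _ , m ← hasLink⇒ h =
      proj₂ (proj₂ (cellLink m)) (subst (_∈ es) (sym (edgeOf-forward c₁ dd)) e∈es)
    same : edgeOf c₂ (opp (forward dd)) ≡ (cellCentre c₁ , dd)
    same = trans (cong (λ c → edgeOf c (opp (forward dd))) c₂≡)
                 (trans (edgeOf-opp c₁ (forward dd)) (edgeOf-forward c₁ dd))
      where
      c₂≡ : c₂ ≡ across (forward dd) c₁
      c₂≡ = cellCentre-injective (trans (sym w≡) (cellCentre-step c₁ dd))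
    far : ¬ HasLink tangle (cellCentre c₁ ⊕ step dd) (opp (forward dd))
    far h with o , m ← hasLink⇒ h =
      proj₂ (proj₂ (cellLink (subst (λ x → olink x _ o ∈ L) w≡ m))) (subst (_∈ es) (sym same) e∈es)

  edge⇐ : ∀ {v dd} → DualVertex tangle v →
          ¬ (HasLink tangle v (forward dd) ⊎ HasLink tangle (v ⊕ step dd) (opp (forward dd))) → (v , dd) ∈ es
  edge⇐ {dd = dd} dv apart with c , c∈Q , refl ← ∈-map⁻ cellCentre (inside⇒ (proj₁ dv))
    with sideCovered (forward dd) c∈Q
  ... | inj₁ m  = ⊥-elim (apart (inj₁ (lose m (refl , refl))))
  ... | inj₂ e∈ = subst (_∈ es) (edgeOf-forward c dd) e∈

  isEdge⇔ : ∀ e → (e ∈ es) ⇔ IsEdge tangle e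
  isEdge⇔ (v , H) = mk⇔ edge⇒ λ (dv , _ , apart) → edge⇐ dv apart
  isEdge⇔ (v , V) = mk⇔ edge⇒ λ (dv , _ , apart) → edge⇐ dv apart

  chanIs : ∀ {P} → Q ↭ P → ChanIs tangle P
  chanIs Q↭P = (+ 0 , + 0) , vertex , cell
    where
    vertex : ∀ c → c ∈ _ → DualVertex tangle ((+ 0 , + 0) ⊕ cellCentre c)
    vertex c c∈P = subst (DualVertex tangle) (sym (⊕-identityˡ _))
                         (dualVertex⇐ (∈-map⁺ cellCentre (∈-resp-↭ (↭.↭-sym Q↭P) c∈P)))
    cell : ∀ v → DualVertex tangle v → Σ Cell λ c → c ∈ _ × v ≡ (+ 0 , + 0) ⊕ cellCentre c
    cell v dv with c , c∈Q , v≡ ← ∈-map⁻ cellCentre (inside⇒ (proj₁ dv)) =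
      c , ∈-resp-↭ Q↭P c∈Q , trans v≡ (sym (⊕-identityˡ _))

mainTheorem6 : (m : ℕ) (P : List Cell) → IsPolyomino P → HoleFree P →
    length P ≡ suc m → Σ Tangle λ T → HasSize T m × ChanIs T P
mainTheorem6 m [] _ _ ()
mainTheorem6 m (p ∷ ps) polyomino _ len
  with Q , Q↭P , es , L , T ← spanning GrownTangle extend polyomino ([] , circle (cellCentre p) , singleton p)
  = tangle , (es , treeUnique , size , isEdge⇔) , chanIs Q↭P
  where
  open ReadOff T
  open TreeTangle T using (treeUnique; treeSize)
  size : length es ≡ m
  size = ℕ.suc-injective (trans treeSize (trans (↭.↭-length Q↭P) len))
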